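{- Let $n \in \mathbb{N}$ and let $\mathbf{P} = \{P_1, \dots, P_m\}$ be a congruence partition of $\mathcal{P}([n])$. Then every class $P_i$ is intersection closed (i.e. $A, B \in P_i$ implies $A \cap B \in P_i$), and for all $A, B \in P_i$ with $A \subseteq B$ it holds $[A,B] := \{X \subseteq B : A \subseteq X\} \subseteq P_i$.
   Context: $[n] = \{1,\dots,n\}$, $\mathcal{P}([n])$ its power set. A map $\tau: \mathcal{P}([n]) \to \mathcal{P}([n])$ is an interior operator if (i) $\tau(X) \subseteq X$ for all $X$, (ii) $X \subseteq Y$ implies $\tau(X) \subseteq \tau(Y)$, and (iii) $\tau(\tau(X)) = \tau(X)$ for all $X$. Writing $\operatorname{Fix}\tau = \{X : \tau(X) = X\}$, the partition $\{\tau^{ -1}(F) : F \in \operatorname{Fix}\tau\}$ of $\mathcal{P}([n])$ is called the congruence partition of $\tau$; a congruence partition is a partition of $\mathcal{P}([n])$ arising this way from some interior operator. -}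

module Defs where

open import Level using (Level; suc; _⊔_)
open import Data.Nat using (ℕ)
open import Data.Product using (Σ; ∃; _×_)
open import Data.Fin.Subset using (Subset; _⊆_; _∩_)
open import Relation.Binary.PropositionalEquality using (_≡_)
open import Function.Bundles using (_⇔_)

-- Subsets of [n] are represented by Subset n = Vec Bool n (characteristic vectors);
-- propositional equality on them is extensional equality of sets.

record IsInteriorOperator {n : ℕ} (τ : Subset n → Subset n) : Set where
  field
    contractive : ∀ X → τ X ⊆ X
    monotone    : ∀ {X Y} → X ⊆ Y → τ X ⊆ τ Y
    idempotent  : ∀ X → τ (τ X) ≡ τ X

Fix : {n : ℕ} → (Subset n → Subset n) → Subset n → Set
Fix τ X = τ X ≡ X

Preimage : {n : ℕ} → (Subset n → Subset n) → Subset n → Subset n → Set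
Preimage τ F X = τ X ≡ F

_≐_ : {n : ℕ} → (Subset n → Set) → (Subset n → Set) → Set
P ≐ Q = ∀ X → P X ⇔ Q X

-- A partition of P([n]) is given by the collection 𝒫 of its classes (a predicate on
-- predicates). 𝒫 is the congruence partition of τ iff its classes are exactly
-- the sets τ⁻¹(F) for F ∈ Fix τ (up to extensional equality of classes).
IsCongruencePartitionOf : {n : ℕ} → (Subset n → Subset n) → ((Subset n → Set) → Set₁) → Set₁
IsCongruencePartitionOf τ 𝒫 =
  ∀ (C : Subset _ → Set) → 𝒫 C ⇔ (∃ λ F → Fix τ F × (C ≐ Preimage τ F))

IsCongruencePartition : {n : ℕ} → ((Subset n → Set) → Set₁) → Set₁
IsCongruencePartition {n} 𝒫 =
  ∃ λ (τ : Subset n → Subset n) → IsInteriorOperator τ × IsCongruencePartitionOf τ 𝒫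

IntersectionClosed : {n : ℕ} → (Subset n → Set) → Set
IntersectionClosed C = ∀ A B → C A → C B → C (A ∩ B)

IntervalClosed : {n : ℕ} → (Subset n → Set) → Set
IntervalClosed C = ∀ A B → C A → C B → A ⊆ B → ∀ X → A ⊆ X → X ⊆ B → C X

{-# OPTIONS --safe #-}
module Submission where

-- A class of the congruence partition is a fibre τ⁻¹(F) with F fixed. Every member X
-- of it satisfies F = τ X ⊆ X, and any Y with F ⊆ Y ⊆ X is squeezed into the same
-- fibre: F = τ F ⊆ τ Y ⊆ τ X = F. Intervals inside the class and intersections of two
-- members (which lie between F and either member) are of this form.

open import Defs
open import Data.Nat using (ℕ)
open import Data.Product using (_×_; _,_)
open import Data.Fin.Subset using (Subset; _⊆_; _∩_)
open import Data.Fin.Subset.Properties using (⊆-antisym; ⊆-trans; p∩q⊆p; x∈p∩q⁺)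
open import Function.Bundles using (Equivalence)
open import Relation.Binary.PropositionalEquality using (subst)

module _ {n : ℕ} {τ : Subset n → Subset n} (io : IsInteriorOperator τ) where
  open IsInteriorOperator io

  fibre-⊆ : ∀ {F X} → Preimage τ F X → F ⊆ X
  fibre-⊆ τX≡F = subst (_⊆ _) τX≡F (contractive _)

  fibre-squeeze : ∀ {F X Y} → Fix τ F → Preimage τ F X → F ⊆ Y → Y ⊆ X →
                  Preimage τ F Y
  fibre-squeeze fixF τX≡F F⊆Y Y⊆X = ⊆-antisym
    (subst (τ _ ⊆_) τX≡F (monotone Y⊆X))
    (subst (_⊆ τ _) fixF (monotone F⊆Y))

  fibre-intervalClosed : ∀ {F} → Fix τ F → IntervalClosed (Preimage τ F)
  fibre-intervalClosed fixF A B τA≡F τB≡F _ X A⊆X X⊆B =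
    fibre-squeeze fixF τB≡F (⊆-trans (fibre-⊆ τA≡F) A⊆X) X⊆B

  fibre-intersectionClosed : ∀ {F} → Fix τ F → IntersectionClosed (Preimage τ F)
  fibre-intersectionClosed fixF A B τA≡F τB≡F = fibre-squeeze fixF τA≡F
    (λ x∈F → x∈p∩q⁺ (fibre-⊆ τA≡F x∈F , fibre-⊆ τB≡F x∈F))
    (p∩q⊆p A B)

module _ {n : ℕ} {C D : Subset n → Set} (C≐D : C ≐ D) where
  private
    to : ∀ {X} → C X → D X
    to {X} = Equivalence.to (C≐D X)

    from : ∀ {X} → D X → C X
    from {X} = Equivalence.from (C≐D X)

  ≐-intersectionClosed : IntersectionClosed D → IntersectionClosed C
  ≐-intersectionClosed closed A B cA cB = from (closed A B (to cA) (to cB))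

  ≐-intervalClosed : IntervalClosed D → IntervalClosed C
  ≐-intervalClosed closed A B cA cB A⊆B X A⊆X X⊆B =
    from (closed A B (to cA) (to cB) A⊆B X A⊆X X⊆B)

corollary3p3 : (n : ℕ) → (𝒫 : (Subset n → Set) → Set₁) → IsCongruencePartition 𝒫 →
    ∀ (C : Subset n → Set) → 𝒫 C → IntersectionClosed C × IntervalClosed C
corollary3p3 n 𝒫 (τ , io , congruence) C 𝒫C
  with F , fixF , C≐fibre ← Equivalence.to (congruence C) 𝒫C
  = ≐-intersectionClosed C≐fibre (fibre-intersectionClosed io fixF)
  , ≐-intervalClosed C≐fibre (fibre-intervalClosed io fixF)
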